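{- For $k\ge 0$ let $C_k(x)=\sum_{n\ge0}c_{n,k}x^n$, where $c_{n,k}$ is the number of words $w=w_1\cdots w_n$ on $\{1,\dots,k\}$ in which every letter of $\{1,\dots,k\}$ occurs, which avoid both generalized patterns $1-11$ and $1-12$, and whose last letter $w_n$ occurs nowhere else in $w$ (i.e. $w_i\ne w_n$ for $i<n$); by convention $C_0(x)=1$ (the empty word). Then \[ C_0(x)=1,\qquad C_k(x)=\sum_{j=1}^{k}\binom{k}{j}x^j\,C_{k-1}(x)\quad (k\ge1). \]
   Context: Words are finite sequences over a totally ordered alphabet $\{1,\dots,k\}$. A word $w$ contains the generalized pattern $1-11$ iff there exist indices $1\le i<j<n$ with $w_i=w_j=w_{j+1}$, and contains $1-12$ iff there exist $i<j<n$ with $w_i=w_j<w_{j+1}$; it avoids a pattern if it does not contain it. -}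

module Defs where

open import Data.Nat using (ℕ; zero; suc; _+_; _*_; _∸_; _<_; _≤?_; _<?_)
open import Data.Nat.Combinatorics using (_C_)
open import Data.Fin using (Fin; toℕ) renaming (_≟_ to _≟ᶠ_)
open import Data.Fin.Properties using (any?; all?)
open import Data.Vec using (Vec; []; _∷_; lookup)
open import Data.List using (List; []; _∷_; length; filter; map; concatMap; sum; upTo)
open import Data.Product using (Σ; ∃; ∃-syntax; _×_; _,_)
open import Relation.Nullary using (¬_; Dec; yes; no; ¬?)
open import Relation.Nullary.Decidable using (_×-dec_; _→-dec_)
open import Relation.Binary.PropositionalEquality using (_≡_; _≢_)
open import Data.Nat using (_≡ᵇ_)

-- A word of length n over the alphabet {1,…,k}, letters encoded as Fin k
-- (letter a+1 ↦ a : Fin k; the order is preserved). Positions are 0-based Fin n.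
Word : ℕ → ℕ → Set
Word k n = Vec (Fin k) n

Contains1-11 : ∀ {k n} → Word k n → Set
Contains1-11 {k} {n} w =
  Σ (Fin n) λ i → Σ (Fin n) λ j → Σ (Fin n) λ l →
    (toℕ i < toℕ j) × (toℕ l ≡ suc (toℕ j)) ×
    (lookup w i ≡ lookup w j) × (lookup w j ≡ lookup w l)

Contains1-12 : ∀ {k n} → Word k n → Set
Contains1-12 {k} {n} w =
  Σ (Fin n) λ i → Σ (Fin n) λ j → Σ (Fin n) λ l →
    (toℕ i < toℕ j) × (toℕ l ≡ suc (toℕ j)) ×
    (lookup w i ≡ lookup w j) × (toℕ (lookup w j) < toℕ (lookup w l))

AllLettersOccur : ∀ {k n} → Word k n → Set
AllLettersOccur {k} {n} w = (a : Fin k) → Σ (Fin n) λ i → lookup w i ≡ a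

LastLetterUnique : ∀ {k n} → Word k n → Set
LastLetterUnique {k} {n} w =
  (i l : Fin n) → suc (toℕ l) ≡ n → toℕ i < toℕ l → lookup w i ≢ lookup w l

Counted : ∀ {k n} → Word k n → Set
Counted w = AllLettersOccur w × ¬ Contains1-11 w × ¬ Contains1-12 w × LastLetterUnique w

private
  ≡ℕ? : (a b : ℕ) → Dec (a ≡ b)
  ≡ℕ? = Data.Nat._≟_
    where import Data.Nat

contains1-11? : ∀ {k n} (w : Word k n) → Dec (Contains1-11 w)
contains1-11? w = any? λ i → any? λ j → any? λ l →
  (_ <? _) ×-dec (≡ℕ? _ _) ×-dec (_ ≟ᶠ _) ×-dec (_ ≟ᶠ _)

contains1-12? : ∀ {k n} (w : Word k n) → Dec (Contains1-12 w)
contains1-12? w = any? λ i → any? λ j → any? λ l →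
  (_ <? _) ×-dec (≡ℕ? _ _) ×-dec (_ ≟ᶠ _) ×-dec (_ <? _)

allLettersOccur? : ∀ {k n} (w : Word k n) → Dec (AllLettersOccur w)
allLettersOccur? w = all? λ a → any? λ i → _ ≟ᶠ _

lastLetterUnique? : ∀ {k n} (w : Word k n) → Dec (LastLetterUnique w)
lastLetterUnique? w = all? λ i → all? λ l →
  (≡ℕ? _ _) →-dec ((_ <? _) →-dec ¬? (_ ≟ᶠ _))

counted? : ∀ {k n} (w : Word k n) → Dec (Counted w)
counted? w = allLettersOccur? w ×-dec ¬? (contains1-11? w) ×-dec
             ¬? (contains1-12? w) ×-dec lastLetterUnique? w

allFinL : (k : ℕ) → List (Fin k)
allFinL zero = []
allFinL (suc k) = Fin.zero ∷ map Fin.suc (allFinL k)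
  where import Data.Fin as Fin

allWords : (k n : ℕ) → List (Word k n)
allWords k zero = [] ∷ []
allWords k (suc n) = concatMap (λ a → map (a ∷_) (allWords k n)) (allFinL k)

c : ℕ → ℕ → ℕ
c n k = length (filter counted? (allWords k n))

-- coefficient of x^n in x^j · C_k(x)
coeffShift : ℕ → ℕ → ℕ → ℕ
coeffShift j n k with j ≤? n
... | yes _ = c (n ∸ j) k
... | no  _ = 0

-- Such words are exactly those in which every repeated letter is immediately
-- followed by a smaller one and the last letter is a first occurrence.  They are
-- recognised by an automaton whose state records the set of letters seen and the
-- bound "next letter < v" left by a repeated letter v; so c n k counts the words
-- accepted from the empty state, and these counts satisfy a transfer recursion
-- (first part of the file).  The core is top-letter: adding
-- a largest letter to the alphabet, the series of every state of the larger
-- automaton is one of these operators applied to the series of the matching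
-- smaller state, r being the number of blocks still to come; it is proved by
-- induction on the length.  At the empty state this is the recurrence.

module Submission where

open import Defs
open import Data.Nat using (ℕ; zero; suc; _+_; _*_; _∸_; _<_; _≤_; z≤n; s≤s; _<ᵇ_; _≤?_)
open import Data.Nat.Properties
open import Data.Nat.Combinatorics using (_C_; nCk+nC[k+1]≡[n+1]C[k+1]; k>n⇒nCk≡0)
open import Data.Nat.Tactic.RingSolver using (solve-∀)
open import Algebra.Properties.CommutativeSemigroup +-commutativeSemigroup
  using () renaming (interchange to +-interchange)
open import Data.List using (List; []; _∷_; map; upTo; applyUpTo; length; filter; concatMap; _++_)
open import Data.List.Properties
  using (filter-++; filter-≐; filter-none; length-++; map-cong; map-++; map-∘)
open import Data.List.Relation.Unary.All as All using ()
open import Data.Nat.ListAction using (sum)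
open import Data.Nat.ListAction.Properties using (sum-++)
open import Data.Product using (_×_; _,_; Σ; proj₁; proj₂)
open import Data.Sum using (_⊎_; inj₁; inj₂)
open import Data.Bool using (Bool; true; false; T; if_then_else_; _∧_)
open import Data.Bool.Properties using (T?; T-≡; ∧-zeroʳ; ∧-identityʳ)
open import Data.Unit using (⊤; tt)
open import Data.Empty using (⊥; ⊥-elim)
open import Data.Maybe using (Maybe; just; nothing)
open import Data.Fin using (Fin; toℕ; inject₁; fromℕ)
  renaming (zero to fzero; suc to fsuc; _≟_ to _≟ᶠ_)
open import Data.Fin.Properties using (toℕ-injective; toℕ-inject₁; toℕ-fromℕ; toℕ<n)
open import Data.Vec using (Vec; []; _∷_; lookup; _[_]≔_; replicate; _∷ʳ_)
open import Data.Vec.Properties using (lookup∘update; lookup∘update′; lookup-replicate)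
open import Function.Bundles using (_⇔_; mk⇔; Equivalence)
open import Relation.Binary using (tri<; tri≈; tri>)
open import Level using (0ℓ)
open import Relation.Nullary using (¬_; Dec; yes; no)
open import Relation.Nullary.Decidable using (_×-dec_)
open import Relation.Unary using (Pred; Decidable; _≐_)
open import Relation.Binary.PropositionalEquality

count : {A : Set} {P : Pred A 0ℓ} → Decidable P → List A → ℕ
count P? xs = length (filter P? xs)

module _ {A : Set} {P : Pred A 0ℓ} (P? : Decidable P) where

  count-≐ : {Q : Pred A 0ℓ} (Q? : Decidable Q) → P ≐ Q → ∀ xs → count P? xs ≡ count Q? xs
  count-≐ Q? P≐Q xs = cong length (filter-≐ P? Q? P≐Q xs)

  count-none : (∀ x → ¬ P x) → ∀ xs → count P? xs ≡ 0
  count-none ¬P xs = cong length (filter-none P? (All.universal ¬P xs))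

  count-++ : ∀ xs ys → count P? (xs ++ ys) ≡ count P? xs + count P? ys
  count-++ xs ys = trans (cong length (filter-++ P? xs ys)) (length-++ (filter P? xs))

  count-concatMap : {B : Set} (f : B → List A) (bs : List B) →
    count P? (concatMap f bs) ≡ sum (map (λ b → count P? (f b)) bs)
  count-concatMap f [] = refl
  count-concatMap f (b ∷ bs) =
    trans (count-++ (f b) (concatMap f bs)) (cong (count P? (f b) +_) (count-concatMap f bs))

  count-map : {B : Set} (g : B → A) (bs : List B) →
    count P? (map g bs) ≡ count (λ b → P? (g b)) bs
  count-map g [] = refl
  count-map g (b ∷ bs) with P? (g b)
  ... | yes _ = cong suc (count-map g bs)
  ... | no _ = count-map g bs

-- Reading a word from left to
-- right it remembers the set of letters seen so far and, when the last letter
-- read was a repeated letter v, the bound "the next letter is smaller than v"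
-- forced by avoiding 1-11 and 1-12.

State : ℕ → Set
State k = Vec Bool k × Maybe (Fin k)

allowed : ∀ {k} → Maybe (Fin k) → Fin k → Bool
allowed nothing a = true
allowed (just v) a = toℕ a <ᵇ toℕ v

step : ∀ {k} → Vec Bool k → Fin k → State k
step S a = if lookup S a then (S , just a) else (S [ a ]≔ true , nothing)

allSeen : ∀ {k} → Vec Bool k → Bool
allSeen [] = true
allSeen (b ∷ S) = b ∧ allSeen S

accepting : ∀ {k} → State k → Bool
accepting (S , nothing) = allSeen S
accepting (S , just _) = false

guard : Bool → ℕ → ℕ
guard true n = n
guard false n = 0

next : ∀ {k} → State k → (State k → ℕ) → ℕ
next {k} (S , p) f = sum (map (λ a → guard (allowed p a) (f (step S a))) (allFinL k))

accepted : ∀ {k} → State k → ℕ → ℕ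
accepted σ zero = guard (accepting σ) 1
accepted σ (suc n) = next σ (λ τ → accepted τ n)

Accepts : ∀ {k n} → State k → Word k n → Set
Accepts σ [] = T (accepting σ)
Accepts (S , p) (a ∷ w) = T (allowed p a) × Accepts (step S a) w

accepts? : ∀ {k n} (σ : State k) (w : Word k n) → Dec (Accepts σ w)
accepts? σ [] = T? (accepting σ)
accepts? (S , p) (a ∷ w) = T? (allowed p a) ×-dec accepts? (step S a) w

-- Since allWords is built letter by letter, counting the accepted words
-- follows the transfer recursion.
count-accepts : ∀ {k} n (σ : State k) → count (accepts? σ) (allWords k n) ≡ accepted σ n
count-accepts zero σ with accepting σ
... | true = refl
... | false = refl
count-accepts {k} (suc n) (S , p) =
  trans (count-concatMap (accepts? (S , p)) (λ a → map (a ∷_) (allWords k n)) (allFinL k))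
        (cong sum (map-cong byFirstLetter (allFinL k)))
  where
  byFirstLetter : ∀ a → count (accepts? (S , p)) (map (a ∷_) (allWords k n))
                      ≡ guard (allowed p a) (accepted (step S a) n)
  byFirstLetter a with allowed p a | count-map (accepts? (S , p)) (a ∷_) (allWords k n)
  ... | true | eq =
    trans eq (trans (count-≐ _ (accepts? (step S a)) (proj₂ , (tt ,_)) (allWords k n))
                    (count-accepts n (step S a)))
  ... | false | eq = trans eq (count-none _ (λ _ → proj₁) (allWords k n))

guard-+ : ∀ b x y → guard b (x + y) ≡ guard b x + guard b y
guard-+ true x y = refl
guard-+ false x y = refl

guard-0 : ∀ b → guard b 0 ≡ 0
guard-0 true = refl
guard-0 false = refl

sum-map-+ : {A : Set} (u v : A → ℕ) (xs : List A) →
  sum (map (λ a → u a + v a) xs) ≡ sum (map u xs) + sum (map v xs)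
sum-map-+ u v [] = refl
sum-map-+ u v (x ∷ xs) = trans (cong (u x + v x +_) (sum-map-+ u v xs)) (+-interchange (u x) (v x) _ _)

sum-map-0 : {A : Set} (u : A → ℕ) → (∀ a → u a ≡ 0) → ∀ xs → sum (map u xs) ≡ 0
sum-map-0 u u≡0 [] = refl
sum-map-0 u u≡0 (x ∷ xs) = cong₂ _+_ (u≡0 x) (sum-map-0 u u≡0 xs)

module _ {k : ℕ} (S : Vec Bool k) (p : Maybe (Fin k)) where

  next-cong : (f g : State k → ℕ) → (∀ a → f (step S a) ≡ g (step S a)) →
              next (S , p) f ≡ next (S , p) g
  next-cong f g f≡g = cong sum (map-cong (λ a → cong (guard (allowed p a)) (f≡g a)) (allFinL k))

  next-+ : (f g : State k → ℕ) →
          next (S , p) (λ τ → f τ + g τ) ≡ next (S , p) f + next (S , p) g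
  next-+ f g = trans (cong sum (map-cong (λ a → guard-+ (allowed p a) _ _) (allFinL k)))
                     (sum-map-+ _ _ (allFinL k))

  next-0 : (f : State k → ℕ) → (∀ a → f (step S a) ≡ 0) → next (S , p) f ≡ 0
  next-0 f f≡0 = sum-map-0 _ (λ a → trans (cong (guard (allowed p a)) (f≡0 a)) (guard-0 (allowed p a)))
                            (allFinL k)

-- For a state (S , p) reached after some prefix,
-- "Continues (S , p) w" expresses that prefix ++ w is counted, in terms of S, p
-- and w only; reading one letter transforms it exactly as the automaton does.

open Equivalence using (to; from)

allSeen⇔ : ∀ {m} (S : Vec Bool m) → T (allSeen S) ⇔ (∀ a → T (lookup S a))
allSeen⇔ [] = mk⇔ (λ _ ()) (λ _ → tt)
allSeen⇔ (true ∷ S) = mk⇔ (λ t → λ { fzero → tt ; (fsuc a) → to (allSeen⇔ S) t a })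
                          (λ all → from (allSeen⇔ S) (λ a → all (fsuc a)))
allSeen⇔ (false ∷ S) = mk⇔ (λ ()) (λ all → all fzero)

module _ {k : ℕ} where

  Seen : Vec Bool k → Fin k → Set
  Seen S b = T (lookup S b)

  Extends : Vec Bool k → Vec Bool k → Fin k → Set
  Extends S′ S a = ∀ b → Seen S′ b ⇔ (Seen S b ⊎ b ≡ a)

  extends-mark : ∀ S a → Extends (S [ a ]≔ true) S a
  extends-mark S a b with b ≟ᶠ a
  ... | yes refl = mk⇔ (λ _ → inj₂ refl) (λ _ → subst T (sym (lookup∘update a S true)) tt)
  ... | no b≢a = mk⇔ (λ t → inj₁ (subst T (lookup∘update′ b≢a S true) t)) λ where
    (inj₁ t) → subst T (sym (lookup∘update′ b≢a S true)) t
    (inj₂ b≡a) → ⊥-elim (b≢a b≡a)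

  extends-seen : ∀ {S a} → Seen S a → Extends S S a
  extends-seen s b = mk⇔ inj₁ λ where
    (inj₁ t) → t
    (inj₂ refl) → s

  Repeat : ∀ {n} → Vec Bool k → Word k n → Fin n → Set
  Repeat {n} S w j =
    Seen S (lookup w j) ⊎ Σ (Fin n) λ i → toℕ i < toℕ j × lookup w i ≡ lookup w j

  Covers : ∀ {n} → Vec Bool k → Word k n → Set
  Covers {n} S w = (a : Fin k) → Seen S a ⊎ Σ (Fin n) λ i → lookup w i ≡ a

  -- every repeated letter is followed by a smaller one (this is 1-11 and 1-12 avoidance)
  Descends : ∀ {n} → Vec Bool k → Word k n → Set
  Descends {n} S w = (j l : Fin n) → toℕ l ≡ suc (toℕ j) → Repeat S w j →
                     toℕ (lookup w l) < toℕ (lookup w j)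

  FreshLast : ∀ {n} → Vec Bool k → Word k n → Set
  FreshLast {n} S w = (l : Fin n) → suc (toℕ l) ≡ n → ¬ Repeat S w l

  Respects : ∀ {n} → Maybe (Fin k) → Word k n → Set
  Respects nothing w = ⊤
  Respects (just v) [] = ⊥
  Respects (just v) (a ∷ w) = toℕ a < toℕ v

  Continues : ∀ {n} → State k → Word k n → Set
  Continues (S , p) w = Covers S w × Descends S w × FreshLast S w × Respects p w

  repeat-zero : ∀ {n} S a (w : Word k n) → Repeat S (a ∷ w) fzero → Seen S a
  repeat-zero S a w (inj₁ s) = s
  repeat-zero S a w (inj₂ (_ , () , _))

  repeat-suc : ∀ {n} S S′ a (w : Word k n) → Extends S′ S a →
    ∀ j → Repeat S (a ∷ w) (fsuc j) ⇔ Repeat S′ w j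
  repeat-suc S S′ a w ext j = mk⇔ forward backward
    where
    forward : Repeat S (a ∷ w) (fsuc j) → Repeat S′ w j
    forward (inj₁ s) = inj₁ (from (ext _) (inj₁ s))
    forward (inj₂ (fzero , _ , a≡wj)) = inj₁ (from (ext _) (inj₂ (sym a≡wj)))
    forward (inj₂ (fsuc i , s≤s i<j , wi≡wj)) = inj₂ (i , i<j , wi≡wj)
    backward : Repeat S′ w j → Repeat S (a ∷ w) (fsuc j)
    backward (inj₁ s) with to (ext _) s
    ... | inj₁ s′ = inj₁ s′
    ... | inj₂ wj≡a = inj₂ (fzero , s≤s z≤n , sym wj≡a)
    backward (inj₂ (i , i<j , wi≡wj)) = inj₂ (fsuc i , s≤s i<j , wi≡wj)

  -- a is covered by itself, so it may be moved into the history
  covers-cons : ∀ {n} S S′ a (w : Word k n) → Extends S′ S a → Covers S (a ∷ w) ⇔ Covers S′ w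
  covers-cons S S′ a w ext = mk⇔ forward backward
    where
    forward : Covers S (a ∷ w) → Covers S′ w
    forward cov b with cov b
    ... | inj₁ s = inj₁ (from (ext b) (inj₁ s))
    ... | inj₂ (fzero , a≡b) = inj₁ (from (ext b) (inj₂ (sym a≡b)))
    ... | inj₂ (fsuc i , wi≡b) = inj₂ (i , wi≡b)
    backward : Covers S′ w → Covers S (a ∷ w)
    backward cov b with cov b
    ... | inj₂ (i , wi≡b) = inj₂ (fsuc i , wi≡b)
    ... | inj₁ s with to (ext b) s
    ... | inj₁ s′ = inj₁ s′
    ... | inj₂ b≡a = inj₂ (fzero , sym b≡a)

  respects-cons : ∀ {n} p a (w : Word k n) → Respects p (a ∷ w) ⇔ T (allowed p a)
  respects-cons nothing a w = mk⇔ (λ _ → tt) (λ _ → tt)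
  respects-cons (just v) a w = mk⇔ <⇒<ᵇ (<ᵇ⇒< (toℕ a) (toℕ v))

  -- reading a, followed by at least one more letter c, into any extension S′ of S;
  -- the only condition linking a to the rest is the descent at position 0
  continues-cons : ∀ {n} S p a c (w : Word k n) S′ p′ → Extends S′ S a →
    ((Repeat S (a ∷ c ∷ w) fzero → toℕ c < toℕ a) ⇔ Respects p′ (c ∷ w)) →
    Continues (S , p) (a ∷ c ∷ w) ⇔ (T (allowed p a) × Continues (S′ , p′) (c ∷ w))
  continues-cons S p a c w S′ p′ ext first = mk⇔ forward backward
    where
    rep = repeat-suc S S′ a (c ∷ w) ext
    forward : Continues (S , p) (a ∷ c ∷ w) → T (allowed p a) × Continues (S′ , p′) (c ∷ w)
    forward (cov , desc , fresh , resp) =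
      to (respects-cons p a (c ∷ w)) resp ,
      to (covers-cons S S′ a (c ∷ w) ext) cov ,
      (λ j l l≡j+1 r → desc (fsuc j) (fsuc l) (cong suc l≡j+1) (from (rep j) r)) ,
      (λ l l+1≡n r → fresh (fsuc l) (cong suc l+1≡n) (from (rep l) r)) ,
      to first (desc fzero (fsuc fzero) refl)
    backward : T (allowed p a) × Continues (S′ , p′) (c ∷ w) → Continues (S , p) (a ∷ c ∷ w)
    backward (ok , cov , desc , fresh , resp) =
      from (covers-cons S S′ a (c ∷ w) ext) cov , desc′ , fresh′ ,
      from (respects-cons p a (c ∷ w)) ok
      where
      desc′ : Descends S (a ∷ c ∷ w)
      desc′ fzero (fsuc fzero) _ r = from first resp r
      desc′ (fsuc j) (fsuc l) l≡j+1 r = desc j l (suc-injective l≡j+1) (to (rep j) r)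
      desc′ fzero fzero () _
      desc′ fzero (fsuc (fsuc _)) () _
      desc′ (fsuc _) fzero () _
      fresh′ : FreshLast S (a ∷ c ∷ w)
      fresh′ fzero () _
      fresh′ (fsuc l) l+1≡n r = fresh l (suc-injective l+1≡n) (to (rep l) r)

  continues-step : ∀ {n} S p a (w : Word k n) →
    Continues (S , p) (a ∷ w) ⇔ (T (allowed p a) × Continues (step S a) w)
  continues-step S p a w with lookup S a in bit≡
  continues-step S p a [] | true =
    mk⇔ (λ (_ , _ , fresh , _) → ⊥-elim (fresh fzero refl (inj₁ (subst T (sym bit≡) tt))))
        (λ ())
  continues-step S p a [] | false = mk⇔ forward backward
    where
    ext = extends-mark S a
    forward : Continues (S , p) (a ∷ []) → T (allowed p a) × Continues (S [ a ]≔ true , nothing) []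
    forward (cov , _ , _ , resp) =
      to (respects-cons p a []) resp , to (covers-cons S (S [ a ]≔ true) a [] ext) cov ,
      (λ ()) , (λ ()) , tt
    backward : T (allowed p a) × Continues (S [ a ]≔ true , nothing) [] → Continues (S , p) (a ∷ [])
    backward (ok , cov , _) =
      from (covers-cons S (S [ a ]≔ true) a [] ext) cov , (λ { fzero fzero () }) , fresh ,
      from (respects-cons p a []) ok
      where
      fresh : FreshLast S (a ∷ [])
      fresh fzero _ r = subst T bit≡ (repeat-zero S a [] r)
  continues-step S p a (c ∷ w) | true =
    continues-cons S p a c w S (just a) (extends-seen {S} {a} (subst T (sym bit≡) tt))
      (mk⇔ (λ below → below (inj₁ (subst T (sym bit≡) tt))) (λ c<a _ → c<a))
  continues-step S p a (c ∷ w) | false =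
    continues-cons S p a c w (S [ a ]≔ true) nothing (extends-mark S a)
      (mk⇔ (λ _ → tt) (λ _ r → ⊥-elim (subst T bit≡ (repeat-zero S a (c ∷ w) r))))

  continues-nil : (σ : State k) → Continues σ [] ⇔ T (accepting σ)
  continues-nil (S , nothing) =
    mk⇔ (λ (cov , _) → from (allSeen⇔ S) (λ a → seenOrAbsent (cov a)))
        (λ all → (λ a → inj₁ (to (allSeen⇔ S) all a)) , (λ ()) , (λ ()) , tt)
    where
    seenOrAbsent : ∀ {a} → Seen S a ⊎ Σ (Fin 0) (λ i → lookup [] i ≡ a) → Seen S a
    seenOrAbsent (inj₁ s) = s
    seenOrAbsent (inj₂ (() , _))
  continues-nil (S , just v) = mk⇔ (λ { (_ , _ , _ , ()) }) (λ ())

  continues⇔accepts : ∀ {n} (σ : State k) (w : Word k n) → Continues σ w ⇔ Accepts σ w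
  continues⇔accepts σ [] = continues-nil σ
  continues⇔accepts (S , p) (a ∷ w) =
    mk⇔ (λ cont → let (ok , cont′) = to (continues-step S p a w) cont
                  in ok , to (continues⇔accepts (step S a) w) cont′)
        (λ (ok , acc) → from (continues-step S p a w)
                                (ok , from (continues⇔accepts (step S a) w) acc))

  start : State k
  start = replicate k false , nothing

  -- from the start state the conditions say exactly that w is counted: a repeat
  -- followed by an equal or larger letter is an occurrence of 1-11 or 1-12
  counted⇔continues : ∀ {n} (w : Word k n) → Counted w ⇔ Continues start w
  counted⇔continues w = mk⇔ forward backward
    where
    unseen : ∀ a → ¬ Seen (replicate k false) a
    unseen a = subst T (lookup-replicate a false)
    forward : Counted w → Continues start w
    forward (occ , no11 , no12 , lastUnique) = (λ a → inj₂ (occ a)) , desc , fresh , tt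
      where
      desc : Descends (replicate k false) w
      desc j l _ (inj₁ s) = ⊥-elim (unseen _ s)
      desc j l l≡j+1 (inj₂ (i , i<j , wi≡wj)) with <-cmp (toℕ (lookup w j)) (toℕ (lookup w l))
      ... | tri< wj<wl _ _ = ⊥-elim (no12 (i , j , l , i<j , l≡j+1 , wi≡wj , wj<wl))
      ... | tri≈ _ wj≡wl _ =
        ⊥-elim (no11 (i , j , l , i<j , l≡j+1 , wi≡wj , toℕ-injective wj≡wl))
      ... | tri> _ _ wl<wj = wl<wj
      fresh : FreshLast (replicate k false) w
      fresh l _ (inj₁ s) = unseen _ s
      fresh l l+1≡n (inj₂ (i , i<l , wi≡wl)) = lastUnique i l l+1≡n i<l wi≡wl
    backward : Continues start w → Counted w
    backward (cov , desc , fresh , _) = occ , no11 , no12 , lastUnique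
      where
      occ : AllLettersOccur w
      occ a with cov a
      ... | inj₁ s = ⊥-elim (unseen a s)
      ... | inj₂ found = found
      no11 : ¬ Contains1-11 w
      no11 (i , j , l , i<j , l≡j+1 , wi≡wj , wj≡wl) =
        <-irrefl (cong toℕ (sym wj≡wl)) (desc j l l≡j+1 (inj₂ (i , i<j , wi≡wj)))
      no12 : ¬ Contains1-12 w
      no12 (i , j , l , i<j , l≡j+1 , wi≡wj , wj<wl) =
        <-asym wj<wl (desc j l l≡j+1 (inj₂ (i , i<j , wi≡wj)))
      lastUnique : LastLetterUnique w
      lastUnique i l l+1≡n i<l wi≡wl = fresh l l+1≡n (inj₂ (i , i<l , wi≡wl))

  c≡accepted : ∀ n → c n k ≡ accepted start n
  c≡accepted n =
    trans (count-≐ counted? (accepts? start)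
            ((λ {w} cnt → to (continues⇔accepts start w) (to (counted⇔continues w) cnt)) ,
             (λ {w} acc → from (counted⇔continues w) (from (continues⇔accepts start w) acc)))
            (allWords k n))
          (count-accepts n start)

-- Formal power series over ℕ, represented by their coefficient sequences.
-- binom r f is (1 + x)^r · f and binom⁺ r f is ((1 + x)^r − 1) · f, defined by
-- the recursion (1 + x)^(r+1) − 1 = ((1 + x)^r − 1) + x (1 + x)^r.

Series : Set
Series = ℕ → ℕ

mutual
  binom : ℕ → Series → Series
  binom r f n = f n + binom⁺ r f n

  binom⁺ : ℕ → Series → Series
  binom⁺ zero f n = 0
  binom⁺ (suc r) f zero = binom⁺ r f zero
  binom⁺ (suc r) f (suc n) = binom⁺ r f (suc n) + binom r f n

binom⁺-zero : ∀ r f → binom⁺ r f zero ≡ 0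
binom⁺-zero zero f = refl
binom⁺-zero (suc r) f = binom⁺-zero r f

pascal : ∀ r j → suc r C suc j ≡ r C j + r C suc j
pascal r j = sym (nCk+nC[k+1]≡[n+1]C[k+1] r j)

binom⁺-suc : ∀ r f n →
  binom⁺ r f (suc n) ≡ binom⁺ r (λ m → f (suc m)) n + (r C suc n) * f 0
binom⁺-suc zero f n = refl
binom⁺-suc (suc r) f zero = begin
  binom⁺ r f 1 + (f 0 + binom⁺ r f 0)
    ≡⟨ cong₂ (λ u v → u + (f 0 + v)) (binom⁺-suc r f 0) (binom⁺-zero r f) ⟩
  (binom⁺ r g 0 + (r C 1) * f 0) + (f 0 + 0)
    ≡⟨ cong (λ u → (u + (r C 1) * f 0) + (f 0 + 0)) (binom⁺-zero r g) ⟩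
  (0 + (r C 1) * f 0) + (f 0 + 0)
    ≡⟨ regroup (r C 1) (f 0) ⟩
  0 + (1 + r C 1) * f 0
    ≡⟨ cong (λ u → u + (1 + r C 1) * f 0) (sym (binom⁺-zero r g)) ⟩
  binom⁺ r g 0 + (1 + r C 1) * f 0
    ≡⟨ cong (λ u → binom⁺ r g 0 + u * f 0) (sym (pascal r 0)) ⟩
  binom⁺ r g 0 + (suc r C 1) * f 0 ∎
  where
  open ≡-Reasoning
  g = λ m → f (suc m)
  regroup : ∀ c a → (0 + c * a) + (a + 0) ≡ 0 + (1 + c) * a
  regroup = solve-∀
binom⁺-suc (suc r) f (suc n) = begin
  binom⁺ r f (suc (suc n)) + (f (suc n) + binom⁺ r f (suc n))
    ≡⟨ cong₂ (λ u v → u + (f (suc n) + v)) (binom⁺-suc r f (suc n)) (binom⁺-suc r f n) ⟩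
  (binom⁺ r g (suc n) + (r C suc (suc n)) * f 0) + (g n + (binom⁺ r g n + (r C suc n) * f 0))
    ≡⟨ regroup (binom⁺ r g (suc n)) (g n) (binom⁺ r g n) (r C suc n) (r C suc (suc n)) (f 0) ⟩
  (binom⁺ r g (suc n) + (g n + binom⁺ r g n)) + (r C suc n + r C suc (suc n)) * f 0
    ≡⟨ cong (λ u → (binom⁺ r g (suc n) + (g n + binom⁺ r g n)) + u * f 0)
            (sym (pascal r (suc n))) ⟩
  (binom⁺ r g (suc n) + (g n + binom⁺ r g n)) + (suc r C suc (suc n)) * f 0 ∎
  where
  open ≡-Reasoning
  g = λ m → f (suc m)
  regroup : ∀ a b c d e x → (a + e * x) + (b + (c + d * x)) ≡ (a + (b + c)) + (d + e) * x
  regroup = solve-∀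

shiftBy : ℕ → Series → Series
shiftBy zero f n = f n
shiftBy (suc j) f zero = 0
shiftBy (suc j) f (suc n) = shiftBy j f n

shiftBy-≤ : ∀ {j n} f → j ≤ n → shiftBy j f n ≡ f (n ∸ j)
shiftBy-≤ {zero} f _ = refl
shiftBy-≤ {suc j} f (s≤s j≤n) = shiftBy-≤ f j≤n

shiftBy-> : ∀ {j n} f → ¬ j ≤ n → shiftBy j f n ≡ 0
shiftBy-> {zero} f j≰n = ⊥-elim (j≰n z≤n)
shiftBy-> {suc j} {zero} f _ = refl
shiftBy-> {suc j} {suc n} f j≰n = shiftBy-> f (λ j≤n → j≰n (s≤s j≤n))

sumBelow : ℕ → (ℕ → ℕ) → ℕ
sumBelow zero g = 0
sumBelow (suc m) g = g 0 + sumBelow m (λ j → g (suc j))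

sum-applyUpTo : ∀ (g h : ℕ → ℕ) m →
  sum (map g (map suc (applyUpTo h m))) ≡ sumBelow m (λ j → g (suc (h j)))
sum-applyUpTo g h zero = refl
sum-applyUpTo g h (suc m) = cong (g (suc (h 0)) +_) (sum-applyUpTo g (λ j → h (suc j)) m)

sumBelow-cong : ∀ {g h} → (∀ j → g j ≡ h j) → ∀ m → sumBelow m g ≡ sumBelow m h
sumBelow-cong g≡h zero = refl
sumBelow-cong g≡h (suc m) = cong₂ _+_ (g≡h 0) (sumBelow-cong (λ j → g≡h (suc j)) m)

sumBelow-+ : ∀ g h m → sumBelow m (λ j → g j + h j) ≡ sumBelow m g + sumBelow m h
sumBelow-+ g h zero = refl
sumBelow-+ g h (suc m) =
  trans (cong (g 0 + h 0 +_) (sumBelow-+ (λ j → g (suc j)) (λ j → h (suc j)) m))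
        (+-interchange (g 0) (h 0) _ _)

sumBelow-last : ∀ g m → sumBelow (suc m) g ≡ sumBelow m g + g m
sumBelow-last g zero = +-comm (g 0) 0
sumBelow-last g (suc m) =
  trans (cong (g 0 +_) (sumBelow-last (λ j → g (suc j)) m)) (sym (+-assoc (g 0) _ _))

sumBelow-0 : ∀ g → (∀ j → g j ≡ 0) → ∀ m → sumBelow m g ≡ 0
sumBelow-0 g g≡0 zero = refl
sumBelow-0 g g≡0 (suc m) =
  cong₂ _+_ (g≡0 0) (sumBelow-0 (λ j → g (suc j)) (λ j → g≡0 (suc j)) m)

binomSum : ℕ → Series → Series
binomSum r f n = sumBelow r (λ j → (r C suc j) * shiftBy (suc j) f n)

-- Pascal's rule splits the sum for r + 1 into the sum for r and x times
-- (f plus the sum for r): the recursion defining binom⁺.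
binomSum-suc : ∀ r f n → binomSum (suc r) f (suc n) ≡ binomSum r f (suc n) + (f n + binomSum r f n)
binomSum-suc r f n = begin
  sumBelow (suc r) (λ j → (suc r C suc j) * x j)
    ≡⟨ sumBelow-cong (λ j → trans (cong (_* x j) (pascal r j))
                                   (*-distribʳ-+ (x j) (r C j) (r C suc j))) (suc r) ⟩
  sumBelow (suc r) (λ j → (r C j) * x j + (r C suc j) * x j)
    ≡⟨ sumBelow-+ (λ j → (r C j) * x j) (λ j → (r C suc j) * x j) (suc r) ⟩
  ((r C 0) * f n + binomSum r f n) + sumBelow (suc r) (λ j → (r C suc j) * x j)
    ≡⟨ cong (((r C 0) * f n + binomSum r f n) +_) (sumBelow-last (λ j → (r C suc j) * x j) r) ⟩
  ((r C 0) * f n + binomSum r f n) + (binomSum r f (suc n) + (r C suc r) * x r)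
    ≡⟨ cong (λ c → ((r C 0) * f n + binomSum r f n) + (binomSum r f (suc n) + c * x r))
            (k>n⇒nCk≡0 (n<1+n r)) ⟩
  (1 * f n + binomSum r f n) + (binomSum r f (suc n) + 0)
    ≡⟨ regroup (f n) (binomSum r f n) (binomSum r f (suc n)) ⟩
  binomSum r f (suc n) + (f n + binomSum r f n) ∎
  where
  open ≡-Reasoning
  x = λ j → shiftBy (suc j) f (suc n)
  regroup : ∀ a b c → (1 * a + b) + (c + 0) ≡ c + (a + b)
  regroup = solve-∀

binom⁺≡binomSum : ∀ r f n → binom⁺ r f n ≡ binomSum r f n
binom⁺≡binomSum zero f n = refl
binom⁺≡binomSum (suc r) f zero =
  trans (binom⁺-zero r f) (sym (sumBelow-0 _ (λ j → *-zeroʳ (suc r C suc j)) (suc r)))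
binom⁺≡binomSum (suc r) f (suc n) = begin
  binom⁺ r f (suc n) + (f n + binom⁺ r f n)
    ≡⟨ cong₂ (λ u v → u + (f n + v)) (binom⁺≡binomSum r f (suc n))
                                      (binom⁺≡binomSum r f n) ⟩
  binomSum r f (suc n) + (f n + binomSum r f n)
    ≡⟨ sym (binomSum-suc r f n) ⟩
  binomSum (suc r) f (suc n) ∎
  where open ≡-Reasoning

binom⁺-closed : ∀ r f n →
  binom⁺ r f n ≡ sum (map (λ j → (r C j) * shiftBy j f n) (map suc (upTo r)))
binom⁺-closed r f n =
  trans (binom⁺≡binomSum r f n) (sym (sum-applyUpTo (λ j → (r C j) * shiftBy j f n) (λ j → j) r))

-- (1 + x)^r − 1 is linear, so it commutes with the transfer step.

binom⁺-next : ∀ {k} r S p (h : State k → Series) n →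
  binom⁺ r (λ m → next (S , p) (λ τ → h τ m)) n ≡ next (S , p) (λ τ → binom⁺ r (h τ) n)
binom⁺-next zero S p h n = sym (next-0 S p _ (λ _ → refl))
binom⁺-next (suc r) S p h zero = binom⁺-next r S p h zero
binom⁺-next (suc r) S p h (suc n) = begin
  binom⁺ r N (suc n) + (N n + binom⁺ r N n)
    ≡⟨ cong₂ (λ u v → u + (N n + v)) (binom⁺-next r S p h (suc n))
                                      (binom⁺-next r S p h n) ⟩
  next σ (λ τ → binom⁺ r (h τ) (suc n)) + (N n + next σ (λ τ → binom⁺ r (h τ) n))
    ≡⟨ cong (next σ (λ τ → binom⁺ r (h τ) (suc n)) +_)
         (sym (next-+ S p (λ τ → h τ n) (λ τ → binom⁺ r (h τ) n))) ⟩
  next σ (λ τ → binom⁺ r (h τ) (suc n)) + next σ (λ τ → binom r (h τ) n)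
    ≡⟨ sym (next-+ S p (λ τ → binom⁺ r (h τ) (suc n)) (λ τ → binom r (h τ) n)) ⟩
  next σ (λ τ → binom⁺ (suc r) (h τ) (suc n)) ∎
  where
  open ≡-Reasoning
  σ = (S , p)
  N = λ m → next σ (λ τ → h τ m)

module _ {k : ℕ} (r : ℕ) (S : Vec Bool k) (p : Maybe (Fin k)) (n : ℕ)
         (vanishes : (r C suc n) * accepted (S , p) 0 ≡ 0) where

  accepted-binom⁺ :
    binom⁺ r (accepted (S , p)) (suc n) ≡ next (S , p) (λ τ → binom⁺ r (accepted τ) n)
  accepted-binom⁺ = begin
    binom⁺ r (accepted σ) (suc n)
      ≡⟨ binom⁺-suc r (accepted σ) n ⟩
    binom⁺ r (λ m → accepted σ (suc m)) n + (r C suc n) * accepted σ 0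
      ≡⟨ cong₂ _+_ (binom⁺-next r S p accepted n) vanishes ⟩
    next σ (λ τ → binom⁺ r (accepted τ) n) + 0
      ≡⟨ +-identityʳ _ ⟩
    next σ (λ τ → binom⁺ r (accepted τ) n) ∎
    where
    open ≡-Reasoning
    σ = (S , p)

  accepted-binom :
    binom r (accepted (S , p)) (suc n) ≡ next (S , p) (λ τ → binom r (accepted τ) n)
  accepted-binom = trans (cong (accepted (S , p) (suc n) +_) accepted-binom⁺)
    (sym (next-+ S p (λ τ → accepted τ n) (λ τ → binom⁺ r (accepted τ) n)))

seenCount : ∀ {k} → Vec Bool k → ℕ
seenCount [] = 0
seenCount (true ∷ S) = suc (seenCount S)
seenCount (false ∷ S) = seenCount S

seenCount≤ : ∀ {k} (S : Vec Bool k) → seenCount S ≤ k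
seenCount≤ [] = z≤n
seenCount≤ (true ∷ S) = s≤s (seenCount≤ S)
seenCount≤ (false ∷ S) = m≤n⇒m≤1+n (seenCount≤ S)

seenCount-mark : ∀ {k} (S : Vec Bool k) b → lookup S b ≡ false →
  seenCount (S [ b ]≔ true) ≡ suc (seenCount S)
seenCount-mark (false ∷ S) fzero _ = refl
seenCount-mark (true ∷ S) (fsuc b) unseen = cong suc (seenCount-mark S b unseen)
seenCount-mark (false ∷ S) (fsuc b) unseen = seenCount-mark S b unseen

seenCount-replicate : ∀ k → seenCount (replicate k false) ≡ 0
seenCount-replicate zero = refl
seenCount-replicate (suc k) = seenCount-replicate k

allSeen⇒seenCount : ∀ {k} (S : Vec Bool k) → allSeen S ≡ true → seenCount S ≡ k
allSeen⇒seenCount [] _ = refl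
allSeen⇒seenCount (true ∷ S) all = cong suc (allSeen⇒seenCount S all)

seenCount<⇒¬allSeen : ∀ {k} (S : Vec Bool k) → seenCount S < k → allSeen S ≡ false
seenCount<⇒¬allSeen S s<k with allSeen S in all
... | true = ⊥-elim (<-irrefl (allSeen⇒seenCount S all) s<k)
... | false = refl

seenCount⇒seen : ∀ {k} (S : Vec Bool k) → seenCount S ≡ k → ∀ b → lookup S b ≡ true
seenCount⇒seen (true ∷ S) full fzero = refl
seenCount⇒seen (true ∷ S) full (fsuc b) = seenCount⇒seen S (suc-injective full) b
seenCount⇒seen {suc k} (false ∷ S) full b =
  ⊥-elim (<-irrefl refl (subst (_≤ k) full (seenCount≤ S)))

-- When every letter is seen, each further letter is a repeat and sets a bound,
-- so the last letter cannot be fresh: no nonempty continuation is accepted.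
full-step : ∀ {k} (S : Vec Bool k) → seenCount S ≡ k → ∀ n b → accepted (step S b) n ≡ 0

full-pending : ∀ {k} (S : Vec Bool k) → seenCount S ≡ k →
  ∀ v n → accepted (S , just v) n ≡ 0
full-pending S full v zero = refl
full-pending S full v (suc n) = next-0 S (just v) (λ τ → accepted τ n) (full-step S full n)

full-step S full n b rewrite seenCount⇒seen S full b = full-pending S full b n

full-free : ∀ {k} (S : Vec Bool k) → seenCount S ≡ k →
  ∀ n → accepted (S , nothing) (suc n) ≡ 0
full-free S full n = next-0 S nothing (λ τ → accepted τ n) (full-step S full n)

-- The constant term of the series of (S , nothing) is nonzero only when S is
-- full; if r = 0 in that case, C(r, n+1) times it vanishes.
constant-vanishes : ∀ {k} (S : Vec Bool k) r n → (seenCount S ≡ k → r ≡ 0) →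
  (r C suc n) * accepted (S , nothing) 0 ≡ 0
constant-vanishes S r n r≡0 with allSeen S in all
... | true rewrite r≡0 (allSeen⇒seenCount S all) = refl
... | false = *-zeroʳ (r C suc n)

-- Adding a top letter to the alphabet: Fin (suc k) is Fin k (via inject₁)
-- followed by the new largest letter fromℕ k, and a seen-set over Fin (suc k)
-- is a seen-set S over Fin k followed by the bit t of the top letter.

allFinL-∷ʳ : ∀ k → allFinL (suc k) ≡ map inject₁ (allFinL k) ++ (fromℕ k ∷ [])
allFinL-∷ʳ zero = refl
allFinL-∷ʳ (suc k) = cong (fzero ∷_) (begin
  map fsuc (allFinL (suc k))
    ≡⟨ cong (map fsuc) (allFinL-∷ʳ k) ⟩
  map fsuc (map inject₁ (allFinL k) ++ (fromℕ k ∷ []))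
    ≡⟨ map-++ fsuc (map inject₁ (allFinL k)) _ ⟩
  map fsuc (map inject₁ (allFinL k)) ++ (fromℕ (suc k) ∷ [])
    ≡⟨ cong (_++ (fromℕ (suc k) ∷ [])) (trans (sym (map-∘ (allFinL k)))
                                              (map-∘ (allFinL k))) ⟩
  map inject₁ (map fsuc (allFinL k)) ++ (fromℕ (suc k) ∷ []) ∎)
  where open ≡-Reasoning

module _ {A : Set} where

  lookup-∷ʳ-inject₁ : ∀ {k} (S : Vec A k) t b → lookup (S ∷ʳ t) (inject₁ b) ≡ lookup S b
  lookup-∷ʳ-inject₁ (x ∷ S) t fzero = refl
  lookup-∷ʳ-inject₁ (x ∷ S) t (fsuc b) = lookup-∷ʳ-inject₁ S t b

  lookup-∷ʳ-fromℕ : ∀ {k} (S : Vec A k) t → lookup (S ∷ʳ t) (fromℕ k) ≡ t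
  lookup-∷ʳ-fromℕ [] t = refl
  lookup-∷ʳ-fromℕ (x ∷ S) t = lookup-∷ʳ-fromℕ S t

  update-∷ʳ-inject₁ : ∀ {k} (S : Vec A k) t b y →
    (S ∷ʳ t) [ inject₁ b ]≔ y ≡ (S [ b ]≔ y) ∷ʳ t
  update-∷ʳ-inject₁ (x ∷ S) t fzero y = refl
  update-∷ʳ-inject₁ (x ∷ S) t (fsuc b) y = cong (x ∷_) (update-∷ʳ-inject₁ S t b y)

  update-∷ʳ-fromℕ : ∀ {k} (S : Vec A k) t y → (S ∷ʳ t) [ fromℕ k ]≔ y ≡ S ∷ʳ y
  update-∷ʳ-fromℕ [] t y = refl
  update-∷ʳ-fromℕ (x ∷ S) t y = cong (x ∷_) (update-∷ʳ-fromℕ S t y)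

  replicate-∷ʳ : ∀ k (x : A) → replicate (suc k) x ≡ replicate k x ∷ʳ x
  replicate-∷ʳ zero x = refl
  replicate-∷ʳ (suc k) x = cong (x ∷_) (replicate-∷ʳ k x)

allSeen-∷ʳ : ∀ {k} (S : Vec Bool k) t → allSeen (S ∷ʳ t) ≡ allSeen S ∧ t
allSeen-∷ʳ [] true = refl
allSeen-∷ʳ [] false = refl
allSeen-∷ʳ (true ∷ S) t = allSeen-∷ʳ S t
allSeen-∷ʳ (false ∷ S) t = refl

-- A pending bound over Fin (suc k), described from Fin k: none, a lower letter,
-- or the top letter itself, which requires the top letter to be seen (t = true).
data Pending (k : ℕ) : Bool → Set where
  free : ∀ {t} → Pending k t
  below : ∀ {t} → Fin k → Pending k t
  top : Pending k true

lift : ∀ {k t} → Pending k t → Maybe (Fin (suc k))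
lift free = nothing
lift (below v) = just (inject₁ v)
lift {k} top = just (fromℕ k)

-- the bound it imposes on the lower letters, all of which lie below the top letter
lower : ∀ {k t} → Pending k t → Maybe (Fin k)
lower free = nothing
lower (below v) = just v
lower top = nothing

pending : ∀ {k t} → Maybe (Fin k) → Pending k t
pending nothing = free
pending (just v) = below v

allowed-inject₁ : ∀ {k t} (q : Pending k t) b →
  allowed (lift q) (inject₁ b) ≡ allowed (lower q) b
allowed-inject₁ free b = refl
allowed-inject₁ (below v) b rewrite toℕ-inject₁ b | toℕ-inject₁ v = refl
allowed-inject₁ {k} top b rewrite toℕ-inject₁ b | toℕ-fromℕ k = to T-≡ (<⇒<ᵇ (toℕ<n b))

top-blocked : ∀ {k} (x : Fin (suc k)) → allowed (just x) (fromℕ k) ≡ false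
top-blocked {k} x with toℕ (fromℕ k) <ᵇ toℕ x in lt
... | false = refl
... | true = ⊥-elim (≤⇒≯ (≤-pred (toℕ<n x))
                       (subst (_< toℕ x) (toℕ-fromℕ k) (<ᵇ⇒< _ _ (subst T (sym lt) tt))))

-- A counted word is a sequence of blocks, each a decreasing run of repeated
-- letters ended by a fresh letter below them; one block is still to come for
-- each of the k ∸ seenCount S unseen lower letters.  Once seen, the top letter
-- may head the run of every block not yet started, a factor 1 + x each.  Before,
-- it still has to form a block of its own, placed before any of the remaining
-- blocks or at the end, which contributes Σᵢ x (1 + x)^i = (1 + x)^(blocks+1) − 1.
-- A pending bound means the current block has started: the top letter can no
-- longer join it, and after a repeated top letter the block cannot end at once.
formula : ∀ {k} (S : Vec Bool k) t → Pending k t → Series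
formula {k} S false free = binom⁺ (suc k ∸ seenCount S) (accepted (S , nothing))
formula {k} S false (below v) = binom⁺ (k ∸ seenCount S) (accepted (S , just v))
formula {k} S true free = binom (k ∸ seenCount S) (accepted (S , nothing))
formula {k} S true (below v) = binom (k ∸ suc (seenCount S)) (accepted (S , just v))
formula {k} S true top zero = 0
formula {k} S true top (suc n) = binom (k ∸ suc (seenCount S)) (accepted (S , nothing)) (suc n)

TopLetter : ℕ → ℕ → Set
TopLetter k n =
  ∀ (S : Vec Bool k) t (q : Pending k t) → accepted (S ∷ʳ t , lift q) n ≡ formula S t q n

formulaAt : ∀ {k} → Bool → ℕ → State k → ℕ
formulaAt t n (S , p) = formula S t (pending p) n

-- One step in the extended alphabet: the lower letters act as in Fin k (by the
-- claim for length n), and the top letter comes last in allFinL (suc k).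
extended-step : ∀ {k} n → TopLetter k n → ∀ S t (q : Pending k t) →
  accepted (S ∷ʳ t , lift q) (suc n)
    ≡ next (S , lower q) (formulaAt t n)
      + guard (allowed (lift q) (fromℕ k)) (accepted (step (S ∷ʳ t) (fromℕ k)) n)
extended-step {k} n claim S t q = begin
  sum (map h (allFinL (suc k)))
    ≡⟨ cong (λ as → sum (map h as)) (allFinL-∷ʳ k) ⟩
  sum (map h (map inject₁ (allFinL k) ++ (fromℕ k ∷ [])))
    ≡⟨ cong sum (map-++ h (map inject₁ (allFinL k)) (fromℕ k ∷ [])) ⟩
  sum (map h (map inject₁ (allFinL k)) ++ (h (fromℕ k) ∷ []))
    ≡⟨ sum-++ (map h (map inject₁ (allFinL k))) (h (fromℕ k) ∷ []) ⟩
  sum (map h (map inject₁ (allFinL k))) + (h (fromℕ k) + 0)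
    ≡⟨ cong₂ _+_ (cong sum (trans (sym (map-∘ (allFinL k))) (map-cong lowerLetter (allFinL k))))
                 (+-identityʳ (h (fromℕ k))) ⟩
  next (S , lower q) (formulaAt t n) + h (fromℕ k) ∎
  where
  open ≡-Reasoning
  h : Fin (suc k) → ℕ
  h a = guard (allowed (lift q) a) (accepted (step (S ∷ʳ t) a) n)
  lowerLetter : ∀ b → h (inject₁ b) ≡ guard (allowed (lower q) b) (formulaAt t n (step S b))
  lowerLetter b rewrite allowed-inject₁ q b | lookup-∷ʳ-inject₁ S t b with lookup S b
  ... | true = cong (guard (allowed (lower q) b)) (claim S t (below b))
  ... | false = cong (guard (allowed (lower q) b))
    (trans (cong (λ S′ → accepted (S′ , nothing) n) (update-∷ʳ-inject₁ S t b true))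
           (claim (S [ b ]≔ true) t free))

-- At a successor of S the formula has a uniform shape: a fresh letter raises
-- seenCount, a repeat creates a bound, and either way one block is used up.
formulaAt-unseenTop : ∀ {k} n (S : Vec Bool k) b →
  formulaAt false n (step S b) ≡ binom⁺ (k ∸ seenCount S) (accepted (step S b)) n
formulaAt-unseenTop n S b with lookup S b in bit≡
... | true = refl
... | false rewrite seenCount-mark S b bit≡ = refl

formulaAt-seenTop : ∀ {k} n (S : Vec Bool k) b →
  formulaAt true n (step S b) ≡ binom (k ∸ suc (seenCount S)) (accepted (step S b)) n
formulaAt-seenTop n S b with lookup S b in bit≡
... | true = refl
... | false rewrite seenCount-mark S b bit≡ = refl

topAfter : ∀ {k} → Bool → Pending k true
topAfter true = top
topAfter false = free

step-top : ∀ {k} (S : Vec Bool k) t → step (S ∷ʳ t) (fromℕ k) ≡ (S ∷ʳ true , lift (topAfter t))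
step-top S true rewrite lookup-∷ʳ-fromℕ S true = refl
step-top S false rewrite lookup-∷ʳ-fromℕ S false =
  cong (_, nothing) (update-∷ʳ-fromℕ S false true)

no-blocks-left : ∀ {k} (S : Vec Bool k) → seenCount S ≡ k → k ∸ seenCount S ≡ 0
no-blocks-left {k} S full = trans (cong (k ∸_) full) (n∸n≡0 k)

no-blocks-after : ∀ {k} (S : Vec Bool k) → seenCount S ≡ k → k ∸ suc (seenCount S) ≡ 0
no-blocks-after {k} S full = m≤n⇒m∸n≡0 (subst (λ s → k ≤ suc s) (sym full) (n≤1+n k))

module TopLetterStep {k : ℕ} (n : ℕ) (claim : TopLetter k n) (S : Vec Bool k) where

  open ≡-Reasoning
  s = seenCount S
  A = accepted (S , nothing)

  unseenTopSteps : ∀ p → next (S , p) (formulaAt false n)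
                         ≡ next (S , p) (λ τ → binom⁺ (k ∸ s) (accepted τ) n)
  unseenTopSteps p =
    next-cong S p (formulaAt false n) (λ τ → binom⁺ (k ∸ s) (accepted τ) n) (formulaAt-unseenTop n S)

  seenTopSteps : ∀ p → next (S , p) (formulaAt true n)
                       ≡ next (S , p) (λ τ → binom (k ∸ suc s) (accepted τ) n)
  seenTopSteps p =
    next-cong S p (formulaAt true n) (λ τ → binom (k ∸ suc s) (accepted τ) n) (formulaAt-seenTop n S)

  afterTop : Bool → ℕ
  afterTop t = accepted (step (S ∷ʳ t) (fromℕ k)) n

  readTop : ∀ t → afterTop t ≡ formula S true (topAfter t) n
  readTop t = trans (cong (λ σ → accepted σ n) (step-top S t)) (claim S true (topAfter t))

  topBlocked : ∀ t v → guard (allowed (just v) (fromℕ k)) (afterTop t) ≡ 0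
  topBlocked t v = cong (λ ok → guard ok (afterTop t)) (top-blocked v)

  unseenTop-free : accepted (S ∷ʳ false , nothing) (suc n) ≡ formula S false free (suc n)
  unseenTop-free = begin
    accepted (S ∷ʳ false , nothing) (suc n)
      ≡⟨ extended-step n claim S false free ⟩
    next (S , nothing) (formulaAt false n) + afterTop false
      ≡⟨ cong₂ _+_ (unseenTopSteps nothing) (readTop false) ⟩
    next (S , nothing) (λ τ → binom⁺ (k ∸ s) (accepted τ) n) + binom (k ∸ s) A n
      ≡⟨ cong (_+ binom (k ∸ s) A n) (sym (accepted-binom⁺ (k ∸ s) S nothing n
           (constant-vanishes S (k ∸ s) n (no-blocks-left S)))) ⟩
    binom⁺ (suc (k ∸ s)) A (suc n)
      ≡⟨ cong (λ r → binom⁺ r A (suc n)) (sym (+-∸-assoc 1 (seenCount≤ S))) ⟩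
    binom⁺ (suc k ∸ s) A (suc n) ∎

  unseenTop-below : ∀ v → accepted (S ∷ʳ false , just (inject₁ v)) (suc n)
                          ≡ formula S false (below v) (suc n)
  unseenTop-below v = begin
    accepted (S ∷ʳ false , just (inject₁ v)) (suc n)
      ≡⟨ extended-step n claim S false (below v) ⟩
    next (S , just v) (formulaAt false n) + guard (allowed (just (inject₁ v)) (fromℕ k)) (afterTop false)
      ≡⟨ cong₂ _+_ (unseenTopSteps (just v)) (topBlocked false (inject₁ v)) ⟩
    next (S , just v) (λ τ → binom⁺ (k ∸ s) (accepted τ) n) + 0
      ≡⟨ +-identityʳ _ ⟩
    next (S , just v) (λ τ → binom⁺ (k ∸ s) (accepted τ) n)
      ≡⟨ sym (accepted-binom⁺ (k ∸ s) S (just v) n (*-zeroʳ ((k ∸ s) C suc n))) ⟩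
    binom⁺ (k ∸ s) (accepted (S , just v)) (suc n) ∎

  seenTop-below : ∀ v → accepted (S ∷ʳ true , just (inject₁ v)) (suc n)
                        ≡ formula S true (below v) (suc n)
  seenTop-below v = begin
    accepted (S ∷ʳ true , just (inject₁ v)) (suc n)
      ≡⟨ extended-step n claim S true (below v) ⟩
    next (S , just v) (formulaAt true n) + guard (allowed (just (inject₁ v)) (fromℕ k)) (afterTop true)
      ≡⟨ cong₂ _+_ (seenTopSteps (just v)) (topBlocked true (inject₁ v)) ⟩
    next (S , just v) (λ τ → binom (k ∸ suc s) (accepted τ) n) + 0
      ≡⟨ +-identityʳ _ ⟩
    next (S , just v) (λ τ → binom (k ∸ suc s) (accepted τ) n)
      ≡⟨ sym (accepted-binom (k ∸ suc s) S (just v) n (*-zeroʳ ((k ∸ suc s) C suc n))) ⟩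
    binom (k ∸ suc s) (accepted (S , just v)) (suc n) ∎

  laterBlocks : next (S , nothing) (formulaAt true n) ≡ binom (k ∸ suc s) A (suc n)
  laterBlocks = trans (seenTopSteps nothing)
    (sym (accepted-binom (k ∸ suc s) S nothing n
           (constant-vanishes S (k ∸ suc s) n (no-blocks-after S))))

  seenTop-top : accepted (S ∷ʳ true , just (fromℕ k)) (suc n) ≡ formula S true top (suc n)
  seenTop-top = begin
    accepted (S ∷ʳ true , just (fromℕ k)) (suc n)
      ≡⟨ extended-step n claim S true top ⟩
    next (S , nothing) (formulaAt true n) + guard (allowed (just (fromℕ k)) (fromℕ k)) (afterTop true)
      ≡⟨ cong₂ _+_ laterBlocks (topBlocked true (fromℕ k)) ⟩
    binom (k ∸ suc s) A (suc n) + 0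
      ≡⟨ +-identityʳ _ ⟩
    binom (k ∸ suc s) A (suc n) ∎

  -- With the top letter seen and no bound pending, the top letter may head the
  -- run of the current block, which is the last factor 1 + x; if no lower letter
  -- is left unseen, no block remains and nothing nonempty is accepted.
  currentBlock : s < k ⊎ s ≡ k →
    binom (k ∸ suc s) A (suc n) + formula S true top n ≡ binom (k ∸ s) A (suc n)
  currentBlock (inj₁ s<k) = begin
    binom r A (suc n) + formula S true top n
      ≡⟨ cong (binom r A (suc n) +_) (topRepeated n) ⟩
    binom r A (suc n) + binom r A n
      ≡⟨ +-assoc (A (suc n)) _ _ ⟩
    binom (suc r) A (suc n)
      ≡⟨ cong (λ r′ → binom r′ A (suc n)) (sym (+-∸-assoc 1 s<k)) ⟩
    binom (k ∸ s) A (suc n) ∎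
    where
    r = k ∸ suc s
    topRepeated : ∀ m → formula S true top m ≡ binom r A m
    topRepeated zero rewrite seenCount<⇒¬allSeen S s<k = sym (binom⁺-zero r A)
    topRepeated (suc m) = refl
  currentBlock (inj₂ full) = begin
    binom (k ∸ suc s) A (suc n) + formula S true top n
      ≡⟨ cong₂ _+_ (stuck n) (topRepeated n) ⟩
    0 + 0
      ≡⟨ sym (noneAccepted n) ⟩
    binom 0 A (suc n)
      ≡⟨ cong (λ r → binom r A (suc n)) (sym (no-blocks-left S full)) ⟩
    binom (k ∸ s) A (suc n) ∎
    where
    noneAccepted : ∀ m → binom 0 A (suc m) ≡ 0
    noneAccepted m = trans (+-identityʳ _) (full-free S full m)
    stuck : ∀ m → binom (k ∸ suc s) A (suc m) ≡ 0
    stuck m = trans (cong (λ r → binom r A (suc m)) (no-blocks-after S full)) (noneAccepted m)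
    topRepeated : ∀ m → formula S true top m ≡ 0
    topRepeated zero = refl
    topRepeated (suc m) = stuck m

  seenTop-free : accepted (S ∷ʳ true , nothing) (suc n) ≡ formula S true free (suc n)
  seenTop-free = begin
    accepted (S ∷ʳ true , nothing) (suc n)
      ≡⟨ extended-step n claim S true free ⟩
    next (S , nothing) (formulaAt true n) + afterTop true
      ≡⟨ cong₂ _+_ laterBlocks (readTop true) ⟩
    binom (k ∸ suc s) A (suc n) + formula S true top n
      ≡⟨ currentBlock (m≤n⇒m<n∨m≡n (seenCount≤ S)) ⟩
    binom (k ∸ s) A (suc n) ∎

  claim-suc : ∀ t (q : Pending k t) → accepted (S ∷ʳ t , lift q) (suc n) ≡ formula S t q (suc n)
  claim-suc false free = unseenTop-free
  claim-suc false (below v) = unseenTop-below v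
  claim-suc true free = seenTop-free
  claim-suc true (below v) = seenTop-below v
  claim-suc true top = seenTop-top

top-letter-empty : ∀ {k} → TopLetter k 0
top-letter-empty {k} S false free rewrite allSeen-∷ʳ S false | ∧-zeroʳ (allSeen S) =
  sym (binom⁺-zero (suc k ∸ seenCount S) (accepted (S , nothing)))
top-letter-empty {k} S false (below v) = sym (binom⁺-zero (k ∸ seenCount S) (accepted (S , just v)))
top-letter-empty {k} S true free rewrite allSeen-∷ʳ S true | ∧-identityʳ (allSeen S) =
  sym (trans (cong (guard (allSeen S) 1 +_) (binom⁺-zero (k ∸ seenCount S) (accepted (S , nothing))))
             (+-identityʳ _))
top-letter-empty {k} S true (below v) =
  sym (binom⁺-zero (k ∸ suc (seenCount S)) (accepted (S , just v)))
top-letter-empty S true top = refl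

top-letter : ∀ {k} n → TopLetter k n
top-letter zero = top-letter-empty
top-letter (suc n) S = TopLetterStep.claim-suc n (top-letter n) S

coeffShift≡ : ∀ j n k → coeffShift j n k ≡ shiftBy j (accepted (start {k})) n
coeffShift≡ j n k with j ≤? n
... | yes j≤n = trans (c≡accepted (n ∸ j)) (sym (shiftBy-≤ (accepted start) j≤n))
... | no j≰n = sym (shiftBy-> (accepted start) j≰n)

-- Counted words over k + 1 letters are read
-- from the state where neither the lower letters nor the top letter are seen,
-- whose series is ((1 + x)^(k+1) − 1) C_k(x).
mainTheorem7 : (c 0 0 ≡ 1 × (∀ n → c (suc n) 0 ≡ 0))
    × (∀ k n → c n (suc k)
         ≡ sum (map (λ j → (suc k C j) * coeffShift j n k) (map suc (upTo (suc k)))))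
mainTheorem7 = (refl , λ n → refl) , recurrence
  where
  recurrence : ∀ k n → c n (suc k)
    ≡ sum (map (λ j → (suc k C j) * coeffShift j n k) (map suc (upTo (suc k))))
  recurrence k n = begin
    c n (suc k)
      ≡⟨ c≡accepted n ⟩
    accepted (replicate (suc k) false , nothing) n
      ≡⟨ cong (λ S → accepted (S , nothing) n) (replicate-∷ʳ k false) ⟩
    accepted (replicate k false ∷ʳ false , nothing) n
      ≡⟨ top-letter n (replicate k false) false free ⟩
    binom⁺ (suc k ∸ seenCount (replicate k false)) Cₖ n
      ≡⟨ cong (λ s → binom⁺ (suc k ∸ s) Cₖ n) (seenCount-replicate k) ⟩
    binom⁺ (suc k) Cₖ n
      ≡⟨ binom⁺-closed (suc k) Cₖ n ⟩
    sum (map (λ j → (suc k C j) * shiftBy j Cₖ n) (map suc (upTo (suc k))))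
      ≡⟨ cong sum (map-cong (λ j → cong ((suc k C j) *_) (sym (coeffShift≡ j n k)))
                            (map suc (upTo (suc k)))) ⟩
    sum (map (λ j → (suc k C j) * coeffShift j n k) (map suc (upTo (suc k)))) ∎
    where
    open ≡-Reasoning
    Cₖ = accepted (start {k})
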